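{- Let $S$ be a Kleene relation algebra satisfying the Tarski rule and let $x \in S$ be univalent such that $x \sqcap \overline{1}$ is acyclic. Writing $q = ((x\cdot x)^T)^*$, we have $q \sqcap (x^T \cdot q) = (1 \sqcap x)\cdot\big(q \sqcap (x^T\cdot q)\big)$.
   Context: A Kleene relation algebra is a structure $(S,\sqcup,\sqcap,\cdot,\overline{\phantom{x}},{}^T,{}^*,\bot,\top,1)$ such that $(S,\sqcup,\sqcap,\overline{\phantom{x}},\bot,\top)$ is a Boolean algebra with order $x \sqsubseteq y \iff x \sqcup y = y$; $(S,\sqcup,\cdot,\bot,1)$ is an idempotent semiring ($\cdot$ associative with two-sided unit $1$, distributing over $\sqcup$, $\bot$ a two-sided zero of $\cdot$); transposition satisfies $(x\sqcup y)^T = x^T \sqcup y^T$, $(x^T)^T = x$, $(x\cdot y)^T = y^T\cdot x^T$ and $(x\cdot y)\sqcap z \sqsubseteq x\cdot(y\sqcap(x^T\cdot z))$; and the star satisfies $1\sqcup y\cdot y^* = y^* = 1 \sqcup y^*\cdot y$, $z\sqcup y\cdot x\sqsubseteq x \Rightarrow y^*\cdot z\sqsubseteq x$, $z \sqcup x\cdot y \sqsubseteq x \Rightarrow z\cdot y^*\sqsubseteq x$. The Tarski rule states $\top\cdot x\cdot\top = \top$ for every $x \neq \bot$. Write $x^+ = x\cdot x^*$. An element $x$ is univalent if $x^T x \sqsubseteq 1$ and acyclic if $x^+\sqsubseteq\overline{1}$. -}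

module Defs where

open import Level using (Level; suc)
open import Relation.Binary.PropositionalEquality using (_≡_)
open import Relation.Nullary using (¬_)
open import Algebra.Lattice.Structures using (IsBooleanAlgebra)

record KleeneRelationAlgebra (c : Level) : Set (suc c) where
  infixr 6 _⊔_
  infixr 7 _⊓_
  infixr 8 _·_
  infix 4 _⊑_
  field
    S   : Set c
    _⊔_ : S → S → S
    _⊓_ : S → S → S
    _·_ : S → S → S
    ‾_  : S → S
    _ᵀ  : S → S
    _*  : S → S
    ⊥ ⊤ 𝟏 : S
    isBooleanAlgebra : IsBooleanAlgebra (_≡_ {A = S}) _⊔_ _⊓_ ‾_ ⊤ ⊥

  _⊑_ : S → S → Set c
  x ⊑ y = x ⊔ y ≡ y

  field
    -- idempotent semiring (S, ⊔, ·, ⊥, 1)  (⊔ assoc/comm/idem come from the Boolean algebra)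
    ·-assoc   : ∀ x y z → (x · y) · z ≡ x · (y · z)
    ·-identityˡ : ∀ x → 𝟏 · x ≡ x
    ·-identityʳ : ∀ x → x · 𝟏 ≡ x
    ·-distribˡ-⊔ : ∀ x y z → x · (y ⊔ z) ≡ (x · y) ⊔ (x · z)
    ·-distribʳ-⊔ : ∀ x y z → (y ⊔ z) · x ≡ (y · x) ⊔ (z · x)
    ⊔-identityˡ : ∀ x → ⊥ ⊔ x ≡ x
    ·-zeroˡ   : ∀ x → ⊥ · x ≡ ⊥
    ·-zeroʳ   : ∀ x → x · ⊥ ≡ ⊥
    ᵀ-⊔       : ∀ x y → (x ⊔ y) ᵀ ≡ (x ᵀ) ⊔ (y ᵀ)
    ᵀ-involutive : ∀ x → (x ᵀ) ᵀ ≡ x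
    ᵀ-·       : ∀ x y → (x · y) ᵀ ≡ (y ᵀ) · (x ᵀ)
    dedekind  : ∀ x y z → ((x · y) ⊓ z) ⊑ x · (y ⊓ ((x ᵀ) · z))
    star-unfoldˡ : ∀ y → 𝟏 ⊔ (y · (y *)) ≡ y *
    star-unfoldʳ : ∀ y → 𝟏 ⊔ ((y *) · y) ≡ y *
    star-inductˡ : ∀ x y z → z ⊔ (y · x) ⊑ x → (y *) · z ⊑ x
    star-inductʳ : ∀ x y z → z ⊔ (x · y) ⊑ x → z · (y *) ⊑ x

  _⁺ : S → S
  x ⁺ = x · (x *)

  univalent : S → Set c
  univalent x = (x ᵀ) · x ⊑ 𝟏

  acyclic : S → Set c
  acyclic x = x ⁺ ⊑ ‾ 𝟏

  TarskiRule : Set c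
  TarskiRule = ∀ x → ¬ (x ≡ ⊥) → (⊤ · x) · ⊤ ≡ ⊤

{-# OPTIONS --safe #-}
-- Write d = 𝟏 ⊓ x, u = x ⊓ ‾ 𝟏 and y = q ⊓ xᵀ·q; since d ⊑ 𝟏 only y ⊑ d·y needs
-- proof.  By the Dedekind rule y ⊑ (𝟏 ⊓ y·yᵀ)·y, and since x·x is univalent,
-- y·yᵀ ⊑ q·(x·x)*·x ⊑ q·x ⊔ (x·x)*·x.  Both parts meet 𝟏 below d: splitting
-- x = d ⊔ u gives x⁺ ⊑ d ⊔ u⁺ ⊔ u⁺·d, where acyclicity of u removes the middle
-- term, and the Dedekind rule reduces 𝟏 ⊓ q·x to 𝟏 ⊓ (q·(𝟏 ⊔ x))·d.
module Submission where

open import Defs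
open import Level using (Level)
open import Relation.Binary.PropositionalEquality
  using (_≡_; refl; sym; trans; cong; cong₂; subst₂; isEquivalence)
open import Relation.Binary.Bundles using (Poset)
open import Algebra.Lattice.Bundles using (BooleanAlgebra)
import Algebra.Lattice.Properties.BooleanAlgebra as BooleanAlgebraProperties
import Relation.Binary.Reasoning.PartialOrder as PartialOrderReasoning

module KleeneRelationAlgebraProperties {c : Level} (K : KleeneRelationAlgebra c) where
  open KleeneRelationAlgebra K

  booleanAlgebra : BooleanAlgebra c c
  booleanAlgebra = record { isBooleanAlgebra = isBooleanAlgebra }

  open BooleanAlgebra booleanAlgebra
    using ( ∨-comm; ∨-assoc; ∧-comm; ∨-absorbs-∧; ∨-distribˡ-∧; ∧-distribˡ-∨
          ; ∨-complementʳ; ∧-complementʳ)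
  open BooleanAlgebraProperties booleanAlgebra using (∨-idem; ∧-identityʳ)

  ⊑-refl : ∀ {x} → x ⊑ x
  ⊑-refl {x} = ∨-idem x

  ⊑-reflexive : ∀ {x y} → x ≡ y → x ⊑ y
  ⊑-reflexive refl = ⊑-refl

  ⊑-trans : ∀ {x y z} → x ⊑ y → y ⊑ z → x ⊑ z
  ⊑-trans {x} {y} {z} x⊑y y⊑z =
    trans (cong (x ⊔_) (sym y⊑z)) (trans (sym (∨-assoc x y z)) (trans (cong (_⊔ z) x⊑y) y⊑z))

  ⊑-antisym : ∀ {x y} → x ⊑ y → y ⊑ x → x ≡ y
  ⊑-antisym {x} {y} x⊑y y⊑x = trans (sym y⊑x) (trans (∨-comm y x) x⊑y)

  ⊑-poset : Poset c c c
  ⊑-poset = record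
    { _≈_            = _≡_
    ; _≤_            = _⊑_
    ; isPartialOrder = record
      { isPreorder = record
        { isEquivalence = isEquivalence
        ; reflexive     = ⊑-reflexive
        ; trans         = ⊑-trans
        }
      ; antisym    = ⊑-antisym
      }
    }

  open PartialOrderReasoning ⊑-poset

  x⊑x⊔y : ∀ {x y} → x ⊑ x ⊔ y
  x⊑x⊔y {x} {y} = trans (sym (∨-assoc x x y)) (cong (_⊔ y) (∨-idem x))

  y⊑x⊔y : ∀ {x y} → y ⊑ x ⊔ y
  y⊑x⊔y {x} {y} = subst₂ _⊑_ refl (∨-comm y x) x⊑x⊔y

  ⊔-least : ∀ {x y z} → x ⊑ z → y ⊑ z → x ⊔ y ⊑ z
  ⊔-least {x} {y} {z} x⊑z y⊑z = trans (∨-assoc x y z) (trans (cong (x ⊔_) y⊑z) x⊑z)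

  ⊔-mono-⊑ : ∀ {x x′ y y′} → x ⊑ x′ → y ⊑ y′ → x ⊔ y ⊑ x′ ⊔ y′
  ⊔-mono-⊑ x⊑x′ y⊑y′ = ⊔-least (⊑-trans x⊑x′ x⊑x⊔y) (⊑-trans y⊑y′ y⊑x⊔y)

  x⊓y⊑x : ∀ {x y} → x ⊓ y ⊑ x
  x⊓y⊑x {x} {y} = trans (∨-comm (x ⊓ y) x) (∨-absorbs-∧ x y)

  x⊓y⊑y : ∀ {x y} → x ⊓ y ⊑ y
  x⊓y⊑y {x} {y} = subst₂ _⊑_ (∧-comm y x) refl x⊓y⊑x

  ⊓-greatest : ∀ {x y z} → x ⊑ y → x ⊑ z → x ⊑ y ⊓ z
  ⊓-greatest {x} {y} {z} x⊑y x⊑z = trans (∨-distribˡ-∧ x y z) (cong₂ _⊓_ x⊑y x⊑z)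

  ⊓-mono-⊑ : ∀ {x x′ y y′} → x ⊑ x′ → y ⊑ y′ → x ⊓ y ⊑ x′ ⊓ y′
  ⊓-mono-⊑ x⊑x′ y⊑y′ = ⊓-greatest (⊑-trans x⊓y⊑x x⊑x′) (⊑-trans x⊓y⊑y y⊑y′)

  ⊥-least : ∀ {x} → ⊥ ⊑ x
  ⊥-least {x} = ⊔-identityˡ x

  ⊓-split-by-complement : ∀ x e → x ≡ x ⊓ e ⊔ x ⊓ ‾ e
  ⊓-split-by-complement x e = begin-equality
    x                  ≡⟨ ∧-identityʳ x ⟨
    x ⊓ ⊤              ≡⟨ cong (x ⊓_) (∨-complementʳ e) ⟨
    x ⊓ (e ⊔ ‾ e)      ≡⟨ ∧-distribˡ-∨ x e (‾ e) ⟩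
    x ⊓ e ⊔ x ⊓ ‾ e    ∎

  ⊑-complement⇒⊑⊥ : ∀ {x e} → x ⊑ e → x ⊑ ‾ e → x ⊑ ⊥
  ⊑-complement⇒⊑⊥ {x} {e} x⊑e x⊑‾e = begin
    x        ≤⟨ ⊓-greatest x⊑e x⊑‾e ⟩
    e ⊓ ‾ e  ≡⟨ ∧-complementʳ e ⟩
    ⊥        ∎

  ·-monoʳ-⊑ : ∀ {x x′} z → x ⊑ x′ → z · x ⊑ z · x′
  ·-monoʳ-⊑ {x} {x′} z x⊑x′ = trans (sym (·-distribˡ-⊔ z x x′)) (cong (z ·_) x⊑x′)

  ·-monoˡ-⊑ : ∀ {x x′} z → x ⊑ x′ → x · z ⊑ x′ · z
  ·-monoˡ-⊑ {x} {x′} z x⊑x′ = trans (sym (·-distribʳ-⊔ z x x′)) (cong (_· z) x⊑x′)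

  ·-mono-⊑ : ∀ {x x′ y y′} → x ⊑ x′ → y ⊑ y′ → x · y ⊑ x′ · y′
  ·-mono-⊑ {x} {x′} {y} x⊑x′ y⊑y′ = ⊑-trans (·-monoˡ-⊑ y x⊑x′) (·-monoʳ-⊑ x′ y⊑y′)

  ᵀ-mono-⊑ : ∀ {x y} → x ⊑ y → x ᵀ ⊑ y ᵀ
  ᵀ-mono-⊑ {x} {y} x⊑y = trans (sym (ᵀ-⊔ x y)) (cong _ᵀ x⊑y)

  ᵀ-cancel-⊑ : ∀ {x y} → x ᵀ ⊑ y ᵀ → x ⊑ y
  ᵀ-cancel-⊑ {x} {y} xᵀ⊑yᵀ = subst₂ _⊑_ (ᵀ-involutive x) (ᵀ-involutive y) (ᵀ-mono-⊑ xᵀ⊑yᵀ)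

  𝟏ᵀ : 𝟏 ᵀ ≡ 𝟏
  𝟏ᵀ = begin-equality
    𝟏 ᵀ                ≡⟨ ·-identityʳ (𝟏 ᵀ) ⟨
    𝟏 ᵀ · 𝟏            ≡⟨ cong (𝟏 ᵀ ·_) (ᵀ-involutive 𝟏) ⟨
    𝟏 ᵀ · (𝟏 ᵀ) ᵀ      ≡⟨ ᵀ-· (𝟏 ᵀ) 𝟏 ⟨
    (𝟏 ᵀ · 𝟏) ᵀ        ≡⟨ cong _ᵀ (·-identityʳ (𝟏 ᵀ)) ⟩
    (𝟏 ᵀ) ᵀ            ≡⟨ ᵀ-involutive 𝟏 ⟩
    𝟏                  ∎

  ᵀ-⊓ : ∀ x y → (x ⊓ y) ᵀ ≡ x ᵀ ⊓ y ᵀ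
  ᵀ-⊓ x y = ⊑-antisym ᵀ-⊓-⊑ (ᵀ-cancel-⊑ (begin
    (x ᵀ ⊓ y ᵀ) ᵀ          ≤⟨ ᵀ-⊓-⊑ ⟩
    (x ᵀ) ᵀ ⊓ (y ᵀ) ᵀ      ≡⟨ cong₂ _⊓_ (ᵀ-involutive x) (ᵀ-involutive y) ⟩
    x ⊓ y                  ≡⟨ ᵀ-involutive (x ⊓ y) ⟨
    ((x ⊓ y) ᵀ) ᵀ          ∎))
    where
    ᵀ-⊓-⊑ : ∀ {a b} → (a ⊓ b) ᵀ ⊑ a ᵀ ⊓ b ᵀ
    ᵀ-⊓-⊑ = ⊓-greatest (ᵀ-mono-⊑ x⊓y⊑x) (ᵀ-mono-⊑ x⊓y⊑y)

  dedekindʳ : ∀ x y z → (x · y) ⊓ z ⊑ (x ⊓ (z · y ᵀ)) · y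
  dedekindʳ x y z = ᵀ-cancel-⊑ (begin
    ((x · y) ⊓ z) ᵀ                   ≡⟨ ᵀ-⊓ (x · y) z ⟩
    (x · y) ᵀ ⊓ z ᵀ                   ≡⟨ cong (_⊓ z ᵀ) (ᵀ-· x y) ⟩
    (y ᵀ · x ᵀ) ⊓ z ᵀ                 ≤⟨ dedekind (y ᵀ) (x ᵀ) (z ᵀ) ⟩
    y ᵀ · (x ᵀ ⊓ (y ᵀ) ᵀ · z ᵀ)       ≡⟨ cong (λ t → y ᵀ · (x ᵀ ⊓ t)) (ᵀ-· z (y ᵀ)) ⟨
    y ᵀ · (x ᵀ ⊓ (z · y ᵀ) ᵀ)         ≡⟨ cong (y ᵀ ·_) (ᵀ-⊓ x (z · y ᵀ)) ⟨
    y ᵀ · (x ⊓ (z · y ᵀ)) ᵀ           ≡⟨ ᵀ-· (x ⊓ (z · y ᵀ)) y ⟨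
    ((x ⊓ (z · y ᵀ)) · y) ᵀ           ∎)

  y⊑[𝟏⊓y·yᵀ]·y : ∀ y → y ⊑ (𝟏 ⊓ y · y ᵀ) · y
  y⊑[𝟏⊓y·yᵀ]·y y = begin
    y                  ≤⟨ ⊓-greatest (⊑-reflexive (sym (·-identityˡ y))) ⊑-refl ⟩
    (𝟏 · y) ⊓ y        ≤⟨ dedekindʳ 𝟏 y y ⟩
    (𝟏 ⊓ y · y ᵀ) · y  ∎

  coreflexive⇒e⊑eᵀ : ∀ {e} → e ⊑ 𝟏 → e ⊑ e ᵀ
  coreflexive⇒e⊑eᵀ {e} e⊑𝟏 = begin
    e                    ≤⟨ ⊓-greatest (⊑-reflexive (sym (·-identityʳ e))) ⊑-refl ⟩
    (e · 𝟏) ⊓ e          ≤⟨ dedekind e 𝟏 e ⟩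
    e · (𝟏 ⊓ e ᵀ · e)    ≤⟨ ·-monoʳ-⊑ e x⊓y⊑y ⟩
    e · (e ᵀ · e)        ≤⟨ ·-mono-⊑ e⊑𝟏 (·-monoʳ-⊑ (e ᵀ) e⊑𝟏) ⟩
    𝟏 · (e ᵀ · 𝟏)        ≡⟨ trans (·-identityˡ _) (·-identityʳ (e ᵀ)) ⟩
    e ᵀ                  ∎

  coreflexive-ᵀ : ∀ {e} → e ⊑ 𝟏 → e ᵀ ⊑ 𝟏
  coreflexive-ᵀ e⊑𝟏 = ⊑-trans (ᵀ-mono-⊑ e⊑𝟏) (⊑-reflexive 𝟏ᵀ)

  coreflexive⇒𝟏⊓a·e⊑e : ∀ {e} a → e ⊑ 𝟏 → 𝟏 ⊓ a · e ⊑ e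
  coreflexive⇒𝟏⊓a·e⊑e {e} a e⊑𝟏 = begin
    𝟏 ⊓ a · e              ≡⟨ ∧-comm 𝟏 (a · e) ⟩
    (a · e) ⊓ 𝟏            ≤⟨ dedekindʳ a e 𝟏 ⟩
    (a ⊓ 𝟏 · e ᵀ) · e      ≤⟨ ·-monoˡ-⊑ e x⊓y⊑y ⟩
    (𝟏 · e ᵀ) · e          ≤⟨ ·-monoˡ-⊑ e (⊑-trans (⊑-reflexive (·-identityˡ (e ᵀ))) (coreflexive-ᵀ e⊑𝟏)) ⟩
    𝟏 · e                  ≡⟨ ·-identityˡ e ⟩
    e                      ∎

  coreflexive⇒e·x⊑𝟏 : ∀ {e x} → e ⊑ 𝟏 → e ⊑ x → univalent x → e · x ⊑ 𝟏
  coreflexive⇒e·x⊑𝟏 {e} {x} e⊑𝟏 e⊑x x-univalent = begin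
    e · x      ≤⟨ ·-monoˡ-⊑ x (coreflexive⇒e⊑eᵀ e⊑𝟏) ⟩
    e ᵀ · x    ≤⟨ ·-monoˡ-⊑ x (ᵀ-mono-⊑ e⊑x) ⟩
    x ᵀ · x    ≤⟨ x-univalent ⟩
    𝟏          ∎

  univalent-· : ∀ {x y} → univalent x → univalent y → univalent (x · y)
  univalent-· {x} {y} x-univalent y-univalent = begin
    (x · y) ᵀ · (x · y)        ≡⟨ cong (_· (x · y)) (ᵀ-· x y) ⟩
    (y ᵀ · x ᵀ) · (x · y)      ≡⟨ ·-assoc (y ᵀ) (x ᵀ) (x · y) ⟩
    y ᵀ · (x ᵀ · (x · y))      ≡⟨ cong (y ᵀ ·_) (·-assoc (x ᵀ) x y) ⟨
    y ᵀ · ((x ᵀ · x) · y)      ≤⟨ ·-monoʳ-⊑ (y ᵀ) (·-monoˡ-⊑ y x-univalent) ⟩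
    y ᵀ · (𝟏 · y)              ≡⟨ cong (y ᵀ ·_) (·-identityˡ y) ⟩
    y ᵀ · y                    ≤⟨ y-univalent ⟩
    𝟏                          ∎

  𝟏⊑y* : ∀ y → 𝟏 ⊑ y *
  𝟏⊑y* y = subst₂ _⊑_ refl (star-unfoldˡ y) x⊑x⊔y

  y·y*⊑y* : ∀ y → y · y * ⊑ y *
  y·y*⊑y* y = subst₂ _⊑_ refl (star-unfoldˡ y) y⊑x⊔y

  y⊑y* : ∀ y → y ⊑ y *
  y⊑y* y = begin
    y        ≡⟨ ·-identityʳ y ⟨
    y · 𝟏    ≤⟨ ·-monoʳ-⊑ y (𝟏⊑y* y) ⟩
    y · y *  ≤⟨ y·y*⊑y* y ⟩
    y *      ∎

  y⊑y⁺ : ∀ y → y ⊑ y ⁺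
  y⊑y⁺ y = ⊑-trans (⊑-reflexive (sym (·-identityʳ y))) (·-monoʳ-⊑ y (𝟏⊑y* y))

  *-least : ∀ {x y} → 𝟏 ⊔ y · x ⊑ x → y * ⊑ x
  *-least {x} {y} 𝟏⊔y·x⊑x = subst₂ _⊑_ (·-identityʳ (y *)) refl (star-inductˡ x y 𝟏 𝟏⊔y·x⊑x)

  *-ᵀ : ∀ y → (y *) ᵀ ≡ (y ᵀ) *
  *-ᵀ y = ⊑-antisym (ᵀ-cancel-⊑ (begin
      ((y *) ᵀ) ᵀ        ≡⟨ ᵀ-involutive (y *) ⟩
      y *                ≡⟨ cong _* (ᵀ-involutive y) ⟨
      ((y ᵀ) ᵀ) *        ≤⟨ ᵀ*⊑*ᵀ (y ᵀ) ⟩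
      ((y ᵀ) *) ᵀ        ∎))
    (ᵀ*⊑*ᵀ y)
    where
    ᵀ*⊑*ᵀ : ∀ a → (a ᵀ) * ⊑ (a *) ᵀ
    ᵀ*⊑*ᵀ a = *-least (⊑-reflexive (begin-equality
      𝟏 ⊔ a ᵀ · (a *) ᵀ      ≡⟨ cong₂ _⊔_ (sym 𝟏ᵀ) (sym (ᵀ-· (a *) a)) ⟩
      𝟏 ᵀ ⊔ (a * · a) ᵀ      ≡⟨ ᵀ-⊔ 𝟏 (a * · a) ⟨
      (𝟏 ⊔ a * · a) ᵀ        ≡⟨ cong _ᵀ (star-unfoldʳ a) ⟩
      (a *) ᵀ                ∎))

  [x·x]*⊑x* : ∀ x → (x · x) * ⊑ x *
  [x·x]*⊑x* x = *-least (⊔-least (𝟏⊑y* x) (begin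
    (x · x) · x *    ≡⟨ ·-assoc x x (x *) ⟩
    x · x ⁺          ≤⟨ ·-monoʳ-⊑ x (y·y*⊑y* x) ⟩
    x ⁺              ≤⟨ y·y*⊑y* x ⟩
    x *              ∎))

  [x·x]*·x⊑x⁺ : ∀ x → (x · x) * · x ⊑ x ⁺
  [x·x]*·x⊑x⁺ x = star-inductˡ (x ⁺) (x · x) x (⊔-least (y⊑y⁺ x) (begin
    (x · x) · x ⁺    ≡⟨ ·-assoc x x (x ⁺) ⟩
    x · (x · x ⁺)    ≤⟨ ·-monoʳ-⊑ x (·-monoʳ-⊑ x (y·y*⊑y* x)) ⟩
    x · x ⁺          ≤⟨ ·-monoʳ-⊑ x (y·y*⊑y* x) ⟩
    x ⁺              ∎))

  univalent⇒[wᵀ]*·w*⊑[wᵀ]*⊔w* : ∀ {w} → univalent w → (w ᵀ) * · w * ⊑ (w ᵀ) * ⊔ w *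
  univalent⇒[wᵀ]*·w*⊑[wᵀ]*⊔w* {w} w-univalent =
    star-inductˡ ((w ᵀ) * ⊔ w *) (w ᵀ) (w *) (⊔-least y⊑x⊔y (begin
      w ᵀ · ((w ᵀ) * ⊔ w *)            ≡⟨ ·-distribˡ-⊔ (w ᵀ) ((w ᵀ) *) (w *) ⟩
      w ᵀ · (w ᵀ) * ⊔ w ᵀ · w *        ≤⟨ ⊔-mono-⊑ (y·y*⊑y* (w ᵀ)) wᵀ·w*⊑ᵀ*⊔* ⟩
      (w ᵀ) * ⊔ ((w ᵀ) * ⊔ w *)        ≤⟨ ⊔-least x⊑x⊔y ⊑-refl ⟩
      (w ᵀ) * ⊔ w *                    ∎))
    where
    wᵀ·w*⊑ᵀ*⊔* : w ᵀ · w * ⊑ (w ᵀ) * ⊔ w *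
    wᵀ·w*⊑ᵀ*⊔* = begin
      w ᵀ · w *                      ≡⟨ cong (w ᵀ ·_) (star-unfoldˡ w) ⟨
      w ᵀ · (𝟏 ⊔ w ⁺)                ≡⟨ ·-distribˡ-⊔ (w ᵀ) 𝟏 (w ⁺) ⟩
      w ᵀ · 𝟏 ⊔ w ᵀ · w ⁺            ≡⟨ cong₂ _⊔_ (·-identityʳ (w ᵀ)) (sym (·-assoc (w ᵀ) w (w *))) ⟩
      w ᵀ ⊔ (w ᵀ · w) · w *          ≤⟨ ⊔-mono-⊑ (y⊑y* (w ᵀ)) (·-monoˡ-⊑ (w *) w-univalent) ⟩
      (w ᵀ) * ⊔ 𝟏 · w *              ≡⟨ cong ((w ᵀ) * ⊔_) (·-identityˡ (w *)) ⟩
      (w ᵀ) * ⊔ w *                  ∎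

  module Factorisation (x : S) (x-univalent : univalent x) (u-acyclic : acyclic (x ⊓ ‾ 𝟏)) where

    d u w q y : S
    d = 𝟏 ⊓ x
    u = x ⊓ ‾ 𝟏
    w = x · x
    q = (w ᵀ) *
    y = q ⊓ x ᵀ · q

    d⊑𝟏 : d ⊑ 𝟏
    d⊑𝟏 = x⊓y⊑x

    x≡d⊔u : x ≡ d ⊔ u
    x≡d⊔u = trans (⊓-split-by-complement x 𝟏) (cong (_⊔ u) (∧-comm x 𝟏))

    d·u*⊑d : d · u * ⊑ d
    d·u*⊑d = star-inductʳ d u d (⊔-least ⊑-refl (⊑-trans d·u⊑⊥ ⊥-least))
      where
      d·u⊑⊥ : d · u ⊑ ⊥
      d·u⊑⊥ = ⊑-complement⇒⊑⊥
        (⊑-trans (·-monoʳ-⊑ d x⊓y⊑x) (coreflexive⇒e·x⊑𝟏 d⊑𝟏 x⊓y⊑y x-univalent))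
        (⊑-trans (·-monoˡ-⊑ u d⊑𝟏) (⊑-trans (⊑-reflexive (·-identityˡ u)) x⊓y⊑y))

    x·[u*⊔u*·d]⊑d⊔u⁺⊔u⁺·d : x · (u * ⊔ u * · d) ⊑ d ⊔ u ⁺ ⊔ u ⁺ · d
    x·[u*⊔u*·d]⊑d⊔u⁺⊔u⁺·d = begin
      x · (u * ⊔ u * · d)                          ≡⟨ cong (_· (u * ⊔ u * · d)) x≡d⊔u ⟩
      (d ⊔ u) · (u * ⊔ u * · d)                    ≡⟨ ·-distribʳ-⊔ (u * ⊔ u * · d) d u ⟩
      d · (u * ⊔ u * · d) ⊔ u · (u * ⊔ u * · d)    ≡⟨ cong (d · (u * ⊔ u * · d) ⊔_) (·-distribˡ-⊔ u (u *) (u * · d)) ⟩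
      d · (u * ⊔ u * · d) ⊔ u ⁺ ⊔ u · (u * · d)    ≡⟨ cong (λ t → d · (u * ⊔ u * · d) ⊔ u ⁺ ⊔ t) (·-assoc u (u *) d) ⟨
      d · (u * ⊔ u * · d) ⊔ u ⁺ ⊔ u ⁺ · d          ≤⟨ ⊔-mono-⊑ d·[u*⊔u*·d]⊑d ⊑-refl ⟩
      d ⊔ u ⁺ ⊔ u ⁺ · d                            ∎
      where
      d·[u*⊔u*·d]⊑d : d · (u * ⊔ u * · d) ⊑ d
      d·[u*⊔u*·d]⊑d = begin
        d · (u * ⊔ u * · d)        ≡⟨ ·-distribˡ-⊔ d (u *) (u * · d) ⟩
        d · u * ⊔ d · (u * · d)    ≡⟨ cong (d · u * ⊔_) (·-assoc d (u *) d) ⟨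
        d · u * ⊔ (d · u *) · d    ≤⟨ ⊔-mono-⊑ d·u*⊑d (·-monoˡ-⊑ d d·u*⊑d) ⟩
        d ⊔ d · d                  ≤⟨ ⊔-least ⊑-refl (⊑-trans (·-monoʳ-⊑ d d⊑𝟏) (⊑-reflexive (·-identityʳ d))) ⟩
        d                          ∎

    x*⊑u*⊔u*·d : x * ⊑ u * ⊔ u * · d
    x*⊑u*⊔u*·d = *-least (⊔-least (⊑-trans (𝟏⊑y* u) x⊑x⊔y) (begin
      x · (u * ⊔ u * · d)      ≤⟨ x·[u*⊔u*·d]⊑d⊔u⁺⊔u⁺·d ⟩
      d ⊔ u ⁺ ⊔ u ⁺ · d        ≤⟨ ⊔-least (⊑-trans d⊑u*·d y⊑x⊔y) (⊔-mono-⊑ (y·y*⊑y* u) (·-monoˡ-⊑ d (y·y*⊑y* u))) ⟩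
      u * ⊔ u * · d            ∎))
      where
      d⊑u*·d : d ⊑ u * · d
      d⊑u*·d = ⊑-trans (⊑-reflexive (sym (·-identityˡ d))) (·-monoˡ-⊑ d (𝟏⊑y* u))

    𝟏⊓x⁺⊑d : 𝟏 ⊓ x ⁺ ⊑ d
    𝟏⊓x⁺⊑d = begin
      𝟏 ⊓ x ⁺                                    ≤⟨ ⊓-mono-⊑ ⊑-refl (·-monoʳ-⊑ x x*⊑u*⊔u*·d) ⟩
      𝟏 ⊓ x · (u * ⊔ u * · d)                    ≤⟨ ⊓-mono-⊑ ⊑-refl x·[u*⊔u*·d]⊑d⊔u⁺⊔u⁺·d ⟩
      𝟏 ⊓ (d ⊔ u ⁺ ⊔ u ⁺ · d)                    ≡⟨ ∧-distribˡ-∨ 𝟏 d (u ⁺ ⊔ u ⁺ · d) ⟩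
      𝟏 ⊓ d ⊔ 𝟏 ⊓ (u ⁺ ⊔ u ⁺ · d)                ≡⟨ cong (𝟏 ⊓ d ⊔_) (∧-distribˡ-∨ 𝟏 (u ⁺) (u ⁺ · d)) ⟩
      𝟏 ⊓ d ⊔ 𝟏 ⊓ u ⁺ ⊔ 𝟏 ⊓ u ⁺ · d              ≤⟨ ⊔-least x⊓y⊑y (⊔-least (⊑-trans 𝟏⊓u⁺⊑⊥ ⊥-least) (coreflexive⇒𝟏⊓a·e⊑e (u ⁺) d⊑𝟏)) ⟩
      d                                          ∎
      where
      𝟏⊓u⁺⊑⊥ : 𝟏 ⊓ u ⁺ ⊑ ⊥
      𝟏⊓u⁺⊑⊥ = ⊑-complement⇒⊑⊥ x⊓y⊑x (⊑-trans x⊓y⊑y u-acyclic)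

    𝟏⊓w*·x⊑d : 𝟏 ⊓ w * · x ⊑ d
    𝟏⊓w*·x⊑d = ⊑-trans (⊓-mono-⊑ ⊑-refl ([x·x]*·x⊑x⁺ x)) 𝟏⊓x⁺⊑d

    x⊓w*⊑[𝟏⊔x]·d : x ⊓ w * ⊑ (𝟏 ⊔ x) · d
    x⊓w*⊑[𝟏⊔x]·d = begin
      x ⊓ w *                      ≡⟨ cong (x ⊓_) (star-unfoldˡ w) ⟨
      x ⊓ (𝟏 ⊔ w ⁺)                ≡⟨ ∧-distribˡ-∨ x 𝟏 (w ⁺) ⟩
      x ⊓ 𝟏 ⊔ x ⊓ w ⁺              ≤⟨ ⊔-mono-⊑ (⊑-reflexive (∧-comm x 𝟏)) x⊓w⁺⊑x·d ⟩
      d ⊔ x · d                    ≡⟨ cong (_⊔ x · d) (·-identityˡ d) ⟨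
      𝟏 · d ⊔ x · d                ≡⟨ ·-distribʳ-⊔ d 𝟏 x ⟨
      (𝟏 ⊔ x) · d                  ∎
      where
      x⊓w⁺⊑x·d : x ⊓ w ⁺ ⊑ x · d
      x⊓w⁺⊑x·d = begin
        x ⊓ w ⁺                    ≡⟨ ∧-comm x (w ⁺) ⟩
        w ⁺ ⊓ x                    ≡⟨ cong (_⊓ x) (·-assoc x x (w *)) ⟩
        (x · (x · w *)) ⊓ x        ≤⟨ dedekind x (x · w *) x ⟩
        x · (x · w * ⊓ x ᵀ · x)    ≤⟨ ·-monoʳ-⊑ x (⊓-mono-⊑ (·-monoʳ-⊑ x ([x·x]*⊑x* x)) x-univalent) ⟩
        x · (x ⁺ ⊓ 𝟏)              ≡⟨ cong (x ·_) (∧-comm (x ⁺) 𝟏) ⟩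
        x · (𝟏 ⊓ x ⁺)              ≤⟨ ·-monoʳ-⊑ x 𝟏⊓x⁺⊑d ⟩
        x · d                      ∎

    qᵀ≡w* : q ᵀ ≡ w *
    qᵀ≡w* = trans (*-ᵀ (w ᵀ)) (cong _* (ᵀ-involutive w))

    𝟏⊓q·x⊑d : 𝟏 ⊓ q · x ⊑ d
    𝟏⊓q·x⊑d = begin
      𝟏 ⊓ q · x                    ≤⟨ ⊓-greatest x⊓y⊑x (⊑-trans (⊑-reflexive (∧-comm 𝟏 (q · x))) q·x⊓𝟏⊑q·[𝟏⊔x]·d) ⟩
      𝟏 ⊓ q · ((𝟏 ⊔ x) · d)        ≡⟨ cong (𝟏 ⊓_) (·-assoc q (𝟏 ⊔ x) d) ⟨
      𝟏 ⊓ (q · (𝟏 ⊔ x)) · d        ≤⟨ coreflexive⇒𝟏⊓a·e⊑e (q · (𝟏 ⊔ x)) d⊑𝟏 ⟩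
      d                            ∎
      where
      q·x⊓𝟏⊑q·[𝟏⊔x]·d : (q · x) ⊓ 𝟏 ⊑ q · ((𝟏 ⊔ x) · d)
      q·x⊓𝟏⊑q·[𝟏⊔x]·d = begin
        (q · x) ⊓ 𝟏            ≤⟨ dedekind q x 𝟏 ⟩
        q · (x ⊓ q ᵀ · 𝟏)      ≡⟨ cong (λ t → q · (x ⊓ t)) (trans (·-identityʳ (q ᵀ)) qᵀ≡w*) ⟩
        q · (x ⊓ w *)          ≤⟨ ·-monoʳ-⊑ q x⊓w*⊑[𝟏⊔x]·d ⟩
        q · ((𝟏 ⊔ x) · d)      ∎

    y·yᵀ⊑q·x⊔w*·x : y · y ᵀ ⊑ q · x ⊔ w * · x
    y·yᵀ⊑q·x⊔w*·x = begin
      y · y ᵀ                  ≤⟨ ·-mono-⊑ x⊓y⊑x (ᵀ-mono-⊑ x⊓y⊑y) ⟩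
      q · (x ᵀ · q) ᵀ          ≡⟨ cong (q ·_) (trans (ᵀ-· (x ᵀ) q) (cong₂ _·_ qᵀ≡w* (ᵀ-involutive x))) ⟩
      q · (w * · x)            ≡⟨ ·-assoc q (w *) x ⟨
      (q · w *) · x            ≤⟨ ·-monoˡ-⊑ x (univalent⇒[wᵀ]*·w*⊑[wᵀ]*⊔w* (univalent-· x-univalent x-univalent)) ⟩
      (q ⊔ w *) · x            ≡⟨ ·-distribʳ-⊔ x q (w *) ⟩
      q · x ⊔ w * · x          ∎

    y≡d·y : y ≡ d · y
    y≡d·y = ⊑-antisym y⊑d·y (⊑-trans (·-monoˡ-⊑ y d⊑𝟏) (⊑-reflexive (·-identityˡ y)))
      where
      y⊑d·y : y ⊑ d · y
      y⊑d·y = begin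
        y                                ≤⟨ y⊑[𝟏⊓y·yᵀ]·y y ⟩
        (𝟏 ⊓ y · y ᵀ) · y                ≤⟨ ·-monoˡ-⊑ y (⊓-mono-⊑ ⊑-refl y·yᵀ⊑q·x⊔w*·x) ⟩
        (𝟏 ⊓ (q · x ⊔ w * · x)) · y      ≡⟨ cong (_· y) (∧-distribˡ-∨ 𝟏 (q · x) (w * · x)) ⟩
        (𝟏 ⊓ q · x ⊔ 𝟏 ⊓ w * · x) · y    ≤⟨ ·-monoˡ-⊑ y (⊔-least 𝟏⊓q·x⊑d 𝟏⊓w*·x⊑d) ⟩
        d · y                            ∎

theorem11p1 : {c : Level} (K : KleeneRelationAlgebra c) →
    let open KleeneRelationAlgebra K in
    TarskiRule → (x : S) → univalent x → acyclic (x ⊓ (‾ 𝟏)) →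
    let q = ((x · x) ᵀ) * in
    q ⊓ ((x ᵀ) · q) ≡ (𝟏 ⊓ x) · (q ⊓ ((x ᵀ) · q))
theorem11p1 K _ x x-univalent u-acyclic =
  KleeneRelationAlgebraProperties.Factorisation.y≡d·y K x x-univalent u-acyclic
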